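{- Let $\alpha\in\mathbb{Z}[i]$ be nonzero and let $\bar\alpha$ denote its complex conjugate. Then there exist $d_1,d_2,r,s,u,v\in\mathbb{Z}[i]$, with $d_1,d_2\neq 0$ and $d_1/d_2$ not a square in $\mathbb{Q}(i)$, such that $$d_1r^2-d_2s^2=\alpha,\qquad d_1u^2-d_2v^2=\bar\alpha.$$ -}

module Defs where

open import Data.Integer as ℤ using (ℤ)
open import Data.Rational as ℚ using (ℚ)
open import Data.Product using (_×_; _,_)

record ℤ[i] : Set where
  constructor _+_i
  field
    re : ℤ
    im : ℤ
open ℤ[i] public

infixl 6 _+ᵍ_ _-ᵍ_
infixl 7 _*ᵍ_

_+ᵍ_ : ℤ[i] → ℤ[i] → ℤ[i]
(a + b i) +ᵍ (c + d i) = (a ℤ.+ c) + (b ℤ.+ d) i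

_-ᵍ_ : ℤ[i] → ℤ[i] → ℤ[i]
(a + b i) -ᵍ (c + d i) = (a ℤ.- c) + (b ℤ.- d) i

_*ᵍ_ : ℤ[i] → ℤ[i] → ℤ[i]
(a + b i) *ᵍ (c + d i) = (a ℤ.* c ℤ.- b ℤ.* d) + (a ℤ.* d ℤ.+ b ℤ.* c) i

0ᵍ : ℤ[i]
0ᵍ = ℤ.0ℤ + ℤ.0ℤ i

conj : ℤ[i] → ℤ[i]
conj (a + b i) = a + (ℤ.- b) i

record ℚ[i] : Set where
  constructor _+_iℚ
  field
    reℚ : ℚ
    imℚ : ℚ

_*ℚᵍ_ : ℚ[i] → ℚ[i] → ℚ[i]
(a + b iℚ) *ℚᵍ (c + d iℚ) = (a ℚ.* c ℚ.- b ℚ.* d) + (a ℚ.* d ℚ.+ b ℚ.* c) iℚ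

embed : ℤ[i] → ℚ[i]
embed (a + b i) = (a ℚ./ 1) + (b ℚ./ 1) iℚ

-- For d₂ ≠ 0: d₁/d₂ is a square in ℚ(i) iff ∃ q ∈ ℚ(i) with q² = d₁/d₂,
-- i.e. d₂ · q² = d₁ in ℚ(i).
IsSquareQuot : ℤ[i] → ℤ[i] → Set
IsSquareQuot d₁ d₂ = Σ ℚ[i] λ q → embed d₂ *ℚᵍ (q *ℚᵍ q) ≡ embed d₁
  where open import Data.Product using (Σ)
        open import Relation.Binary.PropositionalEquality using (_≡_)

{-# OPTIONS --safe #-}
module Submission where

open import Defs
open import Data.Product using (Σ; _×_; ∃-syntax)
open import Relation.Binary.PropositionalEquality using (_≡_)
open import Relation.Nullary using (¬_)

open import Algebra.Bundles using (CommutativeRing)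
open import Algebra.Structures {A = ℤ[i]} _≡_ using (IsCommutativeRing)
open import Data.Empty using (⊥; ⊥-elim)
open import Data.Integer as ℤ using (ℤ; +_; -[1+_]; +0; _+_; _*_; _-_; -_)
open import Data.Integer.Divisibility.Signed using (_∣_; divides; ∣ᵤ⇒∣; ∣⇒∣ᵤ; ∣m⇒∣m*n; ∣m+n∣n⇒∣m)
open import Data.Integer.DivMod using (_%_; n%d<d; a≡a%n+[a/n]*n) renaming (_/_ to _div_)
import Data.Integer.Properties as ℤP
open import Data.Integer.Tactic.RingSolver using (solve-∀)
open import Data.Maybe using (just; nothing)
open import Data.Nat as ℕ using (ℕ; suc; s≤s)
open import Data.Nat.Coprimality using (coprime?)
import Data.Nat.Divisibility as ℕ
open import Data.Nat.Induction using (<-wellFounded)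
open import Data.Nat.Primality using (euclidsLemma; prime[2])
import Data.Nat.Properties as ℕP
import Data.Nat.Tactic.RingSolver as ℕ-Solver
open import Data.Product using (_,_)
open import Data.Rational as ℚ using (mkℚ; 0ℚ; toℚᵘ)
import Data.Rational.Properties as ℚP
open import Algebra.Properties.Group ℚP.+-0-group using (⁻¹-involutive)
open import Data.Rational.Unnormalised as ℚᵘ using (mkℚᵘ; _≃_)
import Data.Rational.Unnormalised.Properties as ℚᵘP
open import Data.Sum as Sum using (_⊎_; inj₁; inj₂; [_,_]′; reduce)
open import Function using (id; _∘_; _$_; case_of_)
open import Induction.WellFounded using (module All)
import Relation.Binary.Construct.On as On
open import Relation.Binary.PropositionalEquality
  using (refl; sym; trans; cong; cong₂; subst; isEquivalence; module ≡-Reasoning)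
open import Relation.Nullary.Decidable using (recompute)
import Tactic.RingSolver as RingSolver
open import Tactic.RingSolver.Core.AlmostCommutativeRing using (AlmostCommutativeRing; fromCommutativeRing)

-- If Im α = 2k + 1 is odd, take d₂ = 1, r = u = 1, s = k(1 + i), v = (k + 1)(1 + i) and
-- d₁ = α + s²: then d₁ − s² = α and d₁ − v² = α − 2i(2k + 1) = ᾱ.  Here Im d₁ is odd, and a
-- Gaussian integer with odd imaginary part is never a square (x + yi)² in ℚ(i): with x and y
-- in lowest terms, integrality of x² − y² makes the two denominators even together, oddness
-- of the integer 2xy makes one of them even, and then 4 divides 2·(product of the numerators),
-- so one numerator is even as well.
-- If Re α is odd, solve for −iα instead and multiply d₁, d₂, u and v by i.
-- If Re α and Im α are even, α = (1 + i)²β with β smaller, and scaling r, s by 1 + i and u, v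
-- by 1 − i turns a solution for β into one for α.

negᵍ : ℤ[i] → ℤ[i]
negᵍ (a + b i) = (- a) + (- b) i

1ᵍ iᵍ : ℤ[i]
1ᵍ = (+ 1) + (+ 0) i
iᵍ = (+ 0) + (+ 1) i

ℤ[i]-isCommutativeRing : IsCommutativeRing _+ᵍ_ _*ᵍ_ negᵍ 0ᵍ 1ᵍ
ℤ[i]-isCommutativeRing = record
  { isRing = record
    { +-isAbelianGroup = record
      { isGroup = record
        { isMonoid = record
          { isSemigroup = record
            { isMagma = record { isEquivalence = isEquivalence ; ∙-cong = cong₂ _+ᵍ_ }
            ; assoc   = λ x y z → cong₂ _+_i (ℤP.+-assoc (re x) (re y) (re z)) (ℤP.+-assoc (im x) (im y) (im z))
            }
          ; identity = (λ x → cong₂ _+_i (ℤP.+-identityˡ (re x)) (ℤP.+-identityˡ (im x)))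
                     , (λ x → cong₂ _+_i (ℤP.+-identityʳ (re x)) (ℤP.+-identityʳ (im x)))
          }
        ; inverse = (λ x → cong₂ _+_i (ℤP.+-inverseˡ (re x)) (ℤP.+-inverseˡ (im x)))
                  , (λ x → cong₂ _+_i (ℤP.+-inverseʳ (re x)) (ℤP.+-inverseʳ (im x)))
        ; ⁻¹-cong = cong negᵍ
        }
      ; comm = λ x y → cong₂ _+_i (ℤP.+-comm (re x) (re y)) (ℤP.+-comm (im x) (im y))
      }
    ; *-cong     = cong₂ _*ᵍ_
    ; *-assoc    = λ (a + b i) (c + d i) (e + f i) → cong₂ _+_i (*-assoc-re a b c d e f) (*-assoc-im a b c d e f)
    ; *-identity = (λ (a + b i) → cong₂ _+_i (*-identityˡ-re a b) (*-identityˡ-im a b))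
                 , (λ (a + b i) → cong₂ _+_i (*-identityʳ-re a b) (*-identityʳ-im a b))
    ; distrib    = (λ (a + b i) (c + d i) (e + f i) → cong₂ _+_i (distribˡ-re a b c d e f) (distribˡ-im a b c d e f))
                 , (λ (a + b i) (c + d i) (e + f i) → cong₂ _+_i (distribʳ-re a b c d e f) (distribʳ-im a b c d e f))
    }
  ; *-comm = λ (a + b i) (c + d i) → cong₂ _+_i (*-comm-re a b c d) (*-comm-im a b c d)
  }
  where
  *-assoc-re : ∀ a b c d e f → (a * c - b * d) * e - (a * d + b * c) * f ≡ a * (c * e - d * f) - b * (c * f + d * e)
  *-assoc-re = solve-∀
  *-assoc-im : ∀ a b c d e f → (a * c - b * d) * f + (a * d + b * c) * e ≡ a * (c * f + d * e) + b * (c * e - d * f)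
  *-assoc-im = solve-∀
  *-identityˡ-re : ∀ a b → + 1 * a - + 0 * b ≡ a
  *-identityˡ-re = solve-∀
  *-identityˡ-im : ∀ a b → + 1 * b + + 0 * a ≡ b
  *-identityˡ-im = solve-∀
  *-identityʳ-re : ∀ a b → a * + 1 - b * + 0 ≡ a
  *-identityʳ-re = solve-∀
  *-identityʳ-im : ∀ a b → a * + 0 + b * + 1 ≡ b
  *-identityʳ-im = solve-∀
  distribˡ-re : ∀ a b c d e f → a * (c + e) - b * (d + f) ≡ (a * c - b * d) + (a * e - b * f)
  distribˡ-re = solve-∀
  distribˡ-im : ∀ a b c d e f → a * (d + f) + b * (c + e) ≡ (a * d + b * c) + (a * f + b * e)
  distribˡ-im = solve-∀
  distribʳ-re : ∀ a b c d e f → (c + e) * a - (d + f) * b ≡ (c * a - d * b) + (e * a - f * b)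
  distribʳ-re = solve-∀
  distribʳ-im : ∀ a b c d e f → (c + e) * b + (d + f) * a ≡ (c * b + d * a) + (e * b + f * a)
  distribʳ-im = solve-∀
  *-comm-re : ∀ a b c d → a * c - b * d ≡ c * a - d * b
  *-comm-re = solve-∀
  *-comm-im : ∀ a b c d → a * d + b * c ≡ c * b + d * a
  *-comm-im = solve-∀

ℤ[i]-commutativeRing : CommutativeRing _ _
ℤ[i]-commutativeRing = record { isCommutativeRing = ℤ[i]-isCommutativeRing }

ℤ[i]-ring : AlmostCommutativeRing _ _
ℤ[i]-ring = fromCommutativeRing ℤ[i]-commutativeRing λ { (+0 + +0 i) → just refl ; _ → nothing }

conj-*ᵍ : ∀ x y → conj (x *ᵍ y) ≡ conj x *ᵍ conj y
conj-*ᵍ (a + b i) (c + d i) = cong₂ _+_i (conj-re a b c d) (conj-im a b c d)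
  where
  conj-re : ∀ a b c d → a * c - b * d ≡ a * c - (- b) * (- d)
  conj-re = solve-∀
  conj-im : ∀ a b c d → - (a * d + b * c) ≡ a * (- d) + (- b) * c
  conj-im = solve-∀

parity : ∀ z → + 2 ∣ z ⊎ ∃[ k ] z ≡ + 1 + k * + 2
parity z with z % + 2 | n%d<d z (+ 2) | a≡a%n+[a/n]*n z (+ 2)
... | 0           | _            | z≡ = inj₁ (divides (z div + 2) (trans z≡ (ℤP.+-identityˡ _)))
... | 1           | _            | z≡ = inj₂ (z div + 2 , z≡)
... | suc (suc _) | s≤s (s≤s ()) | _

odd⇒¬2∣ : ∀ {z} k → z ≡ + 1 + k * + 2 → ¬ (+ 2 ∣ z)
odd⇒¬2∣ k refl 2∣z = case ℕ.∣1⇒≡1 (∣⇒∣ᵤ (∣m+n∣n⇒∣m {m = + 1} 2∣z (divides k refl))) of λ ()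

2∣-euclid : ∀ m n → + 2 ∣ m * n → + 2 ∣ m ⊎ + 2 ∣ n
2∣-euclid m n 2∣mn =
  Sum.map ∣ᵤ⇒∣ ∣ᵤ⇒∣ (euclidsLemma _ _ prime[2] (subst (2 ℕ.∣_) (ℤP.abs-* m n) (∣⇒∣ᵤ 2∣mn)))

2∣m*m⇒2∣m : ∀ m → + 2 ∣ m * m → + 2 ∣ m
2∣m*m⇒2∣m m 2∣m² = reduce (2∣-euclid m m 2∣m²)

2∣q⇒2∣s : ∀ {p q s c} → ¬ (+ 2 ∣ p × + 2 ∣ q) → (p * s) * (p * s) ≡ q * c → + 2 ∣ q → + 2 ∣ s
2∣q⇒2∣s {p} {q} {s} {c} p/q-reduced ps²≡qc 2∣q =
  [ (λ 2∣p → ⊥-elim (p/q-reduced (2∣p , 2∣q))) , id ]′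
    (2∣-euclid p s (2∣m*m⇒2∣m (p * s) (subst (+ 2 ∣_) (sym ps²≡qc) (∣m⇒∣m*n c 2∣q))))

2∣q∧2∣s⇒2∣pr : ∀ {p r k q s} → + 2 * p * r ≡ k * q * s → + 2 ∣ q → + 2 ∣ s → + 2 ∣ p * r
2∣q∧2∣s⇒2∣pr {p} {r} {k} 2pr≡kqs (divides q refl) (divides s refl) =
  divides (k * q * s) (ℤP.*-cancelˡ-≡ (+ 2) _ _ (begin
    + 2 * (p * r)             ≡⟨ ℤP.*-assoc (+ 2) p r ⟨
    + 2 * p * r               ≡⟨ 2pr≡kqs ⟩
    k * (q * + 2) * (s * + 2) ≡⟨ regroup k q s ⟩
    + 2 * (k * q * s * + 2)   ∎))
  where
  open ≡-Reasoning
  regroup : ∀ k q s → k * (q * + 2) * (s * + 2) ≡ + 2 * (k * q * s * + 2)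
  regroup = solve-∀

no-odd-double-product-in-lowest-terms : ∀ p q r s k n →
  ¬ (+ 2 ∣ p × + 2 ∣ q) → ¬ (+ 2 ∣ r × + 2 ∣ s) → ¬ (+ 2 ∣ k) →
  + 2 * p * r ≡ k * q * s →
  p * p * (s * s) - r * r * (q * q) ≡ n * (q * q) * (s * s) → ⊥
no-odd-double-product-in-lowest-terms p q r s k n p/q-reduced r/s-reduced k-odd 2pr≡kqs squares =
  [ (λ 2∣p → p/q-reduced (2∣p , 2∣q)) , (λ 2∣r → r/s-reduced (2∣r , 2∣s)) ]′
    (2∣-euclid p r (2∣q∧2∣s⇒2∣pr {p} {r} {k} 2pr≡kqs 2∣q 2∣s))
  where
  ps-square : (p * s) * (p * s) ≡ q * (q * (r * r + n * (s * s)))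
  ps-square = trans (lhs p q r s) (trans (cong (_+ r * r * (q * q)) squares) (rhs q r s n))
    where
    lhs : ∀ p q r s → (p * s) * (p * s) ≡ (p * p * (s * s) - r * r * (q * q)) + r * r * (q * q)
    lhs = solve-∀
    rhs : ∀ q r s n → n * (q * q) * (s * s) + r * r * (q * q) ≡ q * (q * (r * r + n * (s * s)))
    rhs = solve-∀
  rq-square : (r * q) * (r * q) ≡ s * (s * (p * p - n * (q * q)))
  rq-square = trans (lhs p q r s) (trans (cong (λ t → p * p * (s * s) - t) squares) (rhs p q s n))
    where
    lhs : ∀ p q r s → (r * q) * (r * q) ≡ p * p * (s * s) - (p * p * (s * s) - r * r * (q * q))
    lhs = solve-∀
    rhs : ∀ p q s n → p * p * (s * s) - n * (q * q) * (s * s) ≡ s * (s * (p * p - n * (q * q)))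
    rhs = solve-∀
  reorder : ∀ p r → + 2 * p * r ≡ p * r * + 2
  reorder = solve-∀
  2∣q⊎2∣s : + 2 ∣ q ⊎ + 2 ∣ s
  2∣q⊎2∣s with 2∣-euclid (k * q) s (divides (p * r) (trans (sym 2pr≡kqs) (reorder p r)))
  ... | inj₂ 2∣s  = inj₂ 2∣s
  ... | inj₁ 2∣kq = [ (λ 2∣k → ⊥-elim (k-odd 2∣k)) , inj₁ ]′ (2∣-euclid k q 2∣kq)
  2∣q : + 2 ∣ q
  2∣q = [ id , 2∣q⇒2∣s r/s-reduced rq-square ]′ 2∣q⊎2∣s
  2∣s : + 2 ∣ s
  2∣s = 2∣q⇒2∣s p/q-reduced ps-square 2∣q

numerator-denominator-not-both-even : ∀ x → ¬ (+ 2 ∣ ℚ.↥ x × + 2 ∣ ℚ.↧ x)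
numerator-denominator-not-both-even (mkℚ _ _ coprime) (2∣↥ , 2∣↧) =
  case recompute (coprime? _ _) coprime (∣⇒∣ᵤ 2∣↥ , ∣⇒∣ᵤ 2∣↧) of λ ()

integral⇒↥≡ : ∀ {p k} → p ≃ mkℚᵘ k 0 → ℚᵘ.↥ p ≡ k * ℚᵘ.↧ p
integral⇒↥≡ {p} p≃k = trans (sym (ℤP.*-identityʳ (ℚᵘ.↥ p))) (ℚᵘP.drop-*≡* p≃k)

toℚᵘ-integral : ∀ {x} k → x ≡ k ℚ./ 1 → toℚᵘ x ≃ mkℚᵘ k 0
toℚᵘ-integral k refl = ℚP.toℚᵘ-fromℚᵘ (mkℚᵘ k 0)

double-product-numerators : ∀ x y k → x ℚ.* y ℚ.+ y ℚ.* x ≡ k ℚ./ 1 →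
  + 2 * ℚ.↥ x * ℚ.↥ y ≡ k * ℚ.↧ x * ℚ.↧ y
double-product-numerators x@(mkℚ p _ _) y@(mkℚ r _ _) k 2xy≡k = ℤP.*-cancelʳ-≡ _ _ (q * s) (begin
  + 2 * p * r * (q * s)               ≡⟨ expand p r q s ⟩
  p * r * (s * q) + r * p * (q * s)   ≡⟨ integral⇒↥≡ toℚᵘ-2xy≃k ⟩
  k * (q * s * (s * q))               ≡⟨ regroup k q s ⟩
  k * q * s * (q * s)                 ∎)
  where
  open ≡-Reasoning
  q s : ℤ
  q = ℚ.↧ x
  s = ℚ.↧ y
  toℚᵘ-2xy≃k : toℚᵘ x ℚᵘ.* toℚᵘ y ℚᵘ.+ toℚᵘ y ℚᵘ.* toℚᵘ x ≃ mkℚᵘ k 0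
  toℚᵘ-2xy≃k = ℚᵘP.≃-trans
    (ℚᵘP.≃-sym (ℚᵘP.≃-trans (ℚP.toℚᵘ-homo-+ (x ℚ.* y) (y ℚ.* x))
      (ℚᵘP.+-cong (ℚP.toℚᵘ-homo-* x y) (ℚP.toℚᵘ-homo-* y x))))
    (toℚᵘ-integral k 2xy≡k)
  expand : ∀ p r q s → + 2 * p * r * (q * s) ≡ p * r * (s * q) + r * p * (q * s)
  expand = solve-∀
  regroup : ∀ k q s → k * (q * s * (s * q)) ≡ k * q * s * (q * s)
  regroup = solve-∀

difference-of-squares-numerators : ∀ x y n → x ℚ.* x ℚ.- y ℚ.* y ≡ n ℚ./ 1 →
  ℚ.↥ x * ℚ.↥ x * (ℚ.↧ y * ℚ.↧ y) - ℚ.↥ y * ℚ.↥ y * (ℚ.↧ x * ℚ.↧ x) ≡ n * (ℚ.↧ x * ℚ.↧ x) * (ℚ.↧ y * ℚ.↧ y)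
difference-of-squares-numerators x@(mkℚ p _ _) y@(mkℚ r _ _) n x²-y²≡n = begin
  p * p * (s * s) - r * r * (q * q)     ≡⟨ cong (_+_ (p * p * (s * s))) (ℤP.neg-distribˡ-* (r * r) (q * q)) ⟩
  p * p * (s * s) + - (r * r) * (q * q) ≡⟨ integral⇒↥≡ toℚᵘ-x²-y²≃n ⟩
  n * (q * q * (s * s))                 ≡⟨ ℤP.*-assoc n (q * q) (s * s) ⟨
  n * (q * q) * (s * s)                 ∎
  where
  open ≡-Reasoning
  q s : ℤ
  q = ℚ.↧ x
  s = ℚ.↧ y
  toℚᵘ-x²-y²≃n : toℚᵘ x ℚᵘ.* toℚᵘ x ℚᵘ.- toℚᵘ y ℚᵘ.* toℚᵘ y ≃ mkℚᵘ n 0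
  toℚᵘ-x²-y²≃n = ℚᵘP.≃-trans
    (ℚᵘP.≃-sym (ℚᵘP.≃-trans (ℚP.toℚᵘ-homo-+ (x ℚ.* x) (ℚ.- (y ℚ.* y)))
      (ℚᵘP.+-cong (ℚP.toℚᵘ-homo-* x x)
        (ℚᵘP.≃-trans (ℚP.toℚᵘ-homo‿- (y ℚ.* y)) (ℚᵘP.-‿cong (ℚP.toℚᵘ-homo-* y y))))))
    (toℚᵘ-integral n x²-y²≡n)

no-odd-double-product : ∀ x y k n → ¬ (+ 2 ∣ k) →
  x ℚ.* y ℚ.+ y ℚ.* x ≡ k ℚ./ 1 → x ℚ.* x ℚ.- y ℚ.* y ≡ n ℚ./ 1 → ⊥
no-odd-double-product x y k n k-odd 2xy≡k x²-y²≡n =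
  no-odd-double-product-in-lowest-terms (ℚ.↥ x) (ℚ.↧ x) (ℚ.↥ y) (ℚ.↧ y) k n
    (numerator-denominator-not-both-even x) (numerator-denominator-not-both-even y) k-odd
    (double-product-numerators x y k 2xy≡k) (difference-of-squares-numerators x y n x²-y²≡n)

*ℚᵍ-identityˡ : ∀ w → embed 1ᵍ *ℚᵍ w ≡ w
*ℚᵍ-identityˡ (a + b iℚ) = cong₂ _+_iℚ
  (trans (cong₂ ℚ._-_ (ℚP.*-identityˡ a) (ℚP.*-zeroˡ b)) (ℚP.+-identityʳ a))
  (trans (cong₂ ℚ._+_ (ℚP.*-identityˡ b) (ℚP.*-zeroˡ a)) (ℚP.+-identityʳ b))

*ℚᵍ-rotate : ∀ a b → embed iᵍ *ℚᵍ (a + b iℚ) ≡ (ℚ.- b) + a iℚ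
*ℚᵍ-rotate a b = cong₂ _+_iℚ
  (trans (cong₂ ℚ._-_ (ℚP.*-zeroˡ a) (ℚP.*-identityˡ b)) (ℚP.+-identityˡ (ℚ.- b)))
  (trans (cong₂ ℚ._+_ (ℚP.*-zeroˡ b) (ℚP.*-identityˡ a)) (ℚP.+-identityˡ a))

neg-/1 : ∀ k → ℚ.- (k ℚ./ 1) ≡ (- k) ℚ./ 1
neg-/1 (+ 0)       = refl
neg-/1 (+ (suc n)) = refl
neg-/1 (-[1+ n ])  = ⁻¹-involutive (+ suc n ℚ./ 1)

not-square-over-1 : ∀ d → ¬ (+ 2 ∣ im d) → ¬ IsSquareQuot d 1ᵍ
not-square-over-1 d im-odd (x + y iℚ , eq) =
  no-odd-double-product x y (im d) (re d) im-odd (cong ℚ[i].imℚ q²≡d) (cong ℚ[i].reℚ q²≡d)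
  where
  q²≡d : (x + y iℚ) *ℚᵍ (x + y iℚ) ≡ embed d
  q²≡d = trans (sym (*ℚᵍ-identityˡ _)) eq

not-square-over-i : ∀ d → ¬ (+ 2 ∣ im d) → ¬ IsSquareQuot (iᵍ *ᵍ d) iᵍ
not-square-over-i (a + b i) im-odd (x + y iℚ , eq) =
  no-odd-double-product x y b (im (iᵍ *ᵍ (a + b i))) im-odd 2xy≡b (cong ℚ[i].imℚ iq²≡id)
  where
  open ≡-Reasoning
  iq²≡id : (ℚ.- (x ℚ.* y ℚ.+ y ℚ.* x)) + (x ℚ.* x ℚ.- y ℚ.* y) iℚ ≡ embed (iᵍ *ᵍ (a + b i))
  iq²≡id = trans (sym (*ℚᵍ-rotate _ _)) eq
  negate-re : ∀ a b → - (+ 0 * a - + 1 * b) ≡ b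
  negate-re = solve-∀
  2xy≡b : x ℚ.* y ℚ.+ y ℚ.* x ≡ b ℚ./ 1
  2xy≡b = begin
    x ℚ.* y ℚ.+ y ℚ.* x              ≡⟨ ⁻¹-involutive _ ⟨
    ℚ.- (ℚ.- (x ℚ.* y ℚ.+ y ℚ.* x))  ≡⟨ cong ℚ.-_ (cong ℚ[i].reℚ iq²≡id) ⟩
    ℚ.- ((+ 0 * a - + 1 * b) ℚ./ 1)  ≡⟨ neg-/1 (+ 0 * a - + 1 * b) ⟩
    (- (+ 0 * a - + 1 * b)) ℚ./ 1    ≡⟨ cong (ℚ._/ 1) (negate-re a b) ⟩
    b ℚ./ 1                          ∎

square-quotient-of-zero : ∀ d → IsSquareQuot 0ᵍ d
square-quotient-of-zero d = 0ℚ + 0ℚ iℚ , cong₂ _+_iℚ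
  (cong₂ ℚ._-_ (ℚP.*-zeroʳ (re d ℚ./ 1)) (ℚP.*-zeroʳ (im d ℚ./ 1)))
  (cong₂ ℚ._+_ (ℚP.*-zeroʳ (re d ℚ./ 1)) (ℚP.*-zeroʳ (im d ℚ./ 1)))

not-square⇒≢0 : ∀ {d₁} d₂ → ¬ IsSquareQuot d₁ d₂ → ¬ (d₁ ≡ 0ᵍ)
not-square⇒≢0 d₂ not-square refl = not-square (square-quotient-of-zero d₂)

-- x -ᵍ y is spelled x +ᵍ negᵍ y (definitionally the same) because the ring solver does not
-- recognise _-ᵍ_.
record Represents (d₁ d₂ α : ℤ[i]) : Set where
  constructor represents
  field
    x y      : ℤ[i]
    equation : d₁ *ᵍ x *ᵍ x +ᵍ negᵍ (d₂ *ᵍ y *ᵍ y) ≡ α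

RepresentsConjugates : ℤ[i] → ℤ[i] → ℤ[i] → Set
RepresentsConjugates d₁ d₂ α = Represents d₁ d₂ α × Represents d₁ d₂ (conj α)

Representable : ℤ[i] → Set
Representable α = ∃[ d₁ ] ∃[ d₂ ] ¬ IsSquareQuot d₁ d₂ × ¬ (d₂ ≡ 0ᵍ) × RepresentsConjugates d₁ d₂ α

represents-scale : ∀ w {d₁ d₂ α} → Represents d₁ d₂ α → Represents d₁ d₂ (w *ᵍ w *ᵍ α)
represents-scale w {d₁} {d₂} (represents x y eq) =
  represents (w *ᵍ x) (w *ᵍ y) $ trans (form-scale w d₁ d₂ x y) (cong (w *ᵍ w *ᵍ_) eq)
  where
  form-scale : ∀ w d₁ d₂ x y → d₁ *ᵍ (w *ᵍ x) *ᵍ (w *ᵍ x) +ᵍ negᵍ (d₂ *ᵍ (w *ᵍ y) *ᵍ (w *ᵍ y))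
                               ≡ w *ᵍ w *ᵍ (d₁ *ᵍ x *ᵍ x +ᵍ negᵍ (d₂ *ᵍ y *ᵍ y))
  form-scale = RingSolver.solve-∀ ℤ[i]-ring

represents-*ˡ : ∀ c {d₁ d₂ α} → Represents d₁ d₂ α → Represents (c *ᵍ d₁) (c *ᵍ d₂) (c *ᵍ α)
represents-*ˡ c {d₁} {d₂} (represents x y eq) =
  represents x y $ trans (form-*ˡ c d₁ d₂ x y) (cong (c *ᵍ_) eq)
  where
  form-*ˡ : ∀ c d₁ d₂ x y → c *ᵍ d₁ *ᵍ x *ᵍ x +ᵍ negᵍ (c *ᵍ d₂ *ᵍ y *ᵍ y)
                            ≡ c *ᵍ (d₁ *ᵍ x *ᵍ x +ᵍ negᵍ (d₂ *ᵍ y *ᵍ y))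
  form-*ˡ = RingSolver.solve-∀ ℤ[i]-ring

conjugates-scale : ∀ w {d₁ d₂ α} → RepresentsConjugates d₁ d₂ α → RepresentsConjugates d₁ d₂ (w *ᵍ w *ᵍ α)
conjugates-scale w {α = α} (rep , rep̄) =
  represents-scale w rep , subst (Represents _ _) (sym conj-w²α) (represents-scale (conj w) rep̄)
  where
  conj-w²α : conj (w *ᵍ w *ᵍ α) ≡ conj w *ᵍ conj w *ᵍ conj α
  conj-w²α = trans (conj-*ᵍ (w *ᵍ w) α) (cong (_*ᵍ conj α) (conj-*ᵍ w w))

conjugates-rotate : ∀ {d₁ d₂ α} → RepresentsConjugates d₁ d₂ α →
  RepresentsConjugates (iᵍ *ᵍ d₁) (iᵍ *ᵍ d₂) (iᵍ *ᵍ α)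
conjugates-rotate {α = α} (rep , rep̄) =
  represents-*ˡ iᵍ rep , subst (Represents _ _) i³ᾱ≡conj-iα (represents-*ˡ iᵍ (represents-scale iᵍ rep̄))
  where
  i³≡-i : ∀ z → iᵍ *ᵍ (iᵍ *ᵍ iᵍ *ᵍ z) ≡ negᵍ iᵍ *ᵍ z
  i³≡-i = RingSolver.solve-∀ ℤ[i]-ring
  i³ᾱ≡conj-iα : iᵍ *ᵍ (iᵍ *ᵍ iᵍ *ᵍ conj α) ≡ conj (iᵍ *ᵍ α)
  i³ᾱ≡conj-iα = trans (i³≡-i (conj α)) (sym (conj-*ᵍ iᵍ α))

odd-imaginary-representation : ∀ {α} k → im α ≡ + 1 + k * + 2 →
  ∃[ d ] ¬ (+ 2 ∣ im d) × RepresentsConjugates d 1ᵍ α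
odd-imaginary-representation {α} k im≡ =
  α +ᵍ s *ᵍ s , d-odd , represents 1ᵍ s (cancel α s) , represents 1ᵍ v ᾱ≡
  where
  s v : ℤ[i]
  s = k + k i
  v = (k + + 1) + (k + + 1) i
  cancel : ∀ α s → (α +ᵍ s *ᵍ s) *ᵍ 1ᵍ *ᵍ 1ᵍ +ᵍ negᵍ (1ᵍ *ᵍ s *ᵍ s) ≡ α
  cancel = RingSolver.solve-∀ ℤ[i]-ring
  shift : ∀ α s v → (α +ᵍ s *ᵍ s) *ᵍ 1ᵍ *ᵍ 1ᵍ +ᵍ negᵍ (1ᵍ *ᵍ v *ᵍ v) ≡ α +ᵍ s *ᵍ s +ᵍ negᵍ (v *ᵍ v)
  shift = RingSolver.solve-∀ ℤ[i]-ring
  d-im : ∀ k → + 1 + k * + 2 + (k * k + k * k) ≡ + 1 + (k + k * k) * + 2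
  d-im = solve-∀
  ᾱ-re : ∀ a k → a + (k * k - k * k) - ((k + + 1) * (k + + 1) - (k + + 1) * (k + + 1)) ≡ a
  ᾱ-re = solve-∀
  ᾱ-im : ∀ k → + 1 + k * + 2 + (k * k + k * k) - ((k + + 1) * (k + + 1) + (k + + 1) * (k + + 1))
               ≡ - (+ 1 + k * + 2)
  ᾱ-im = solve-∀
  d-odd : ¬ (+ 2 ∣ im α + (k * k + k * k))
  d-odd = odd⇒¬2∣ (k + k * k) (trans (cong (_+ (k * k + k * k)) im≡) (d-im k))
  ᾱ≡ : (α +ᵍ s *ᵍ s) *ᵍ 1ᵍ *ᵍ 1ᵍ +ᵍ negᵍ (1ᵍ *ᵍ v *ᵍ v) ≡ conj α
  ᾱ≡ = trans (shift α s v) (cong₂ _+_i (ᾱ-re (re α) k)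
    (trans (cong (λ b → b + (k * k + k * k) - ((k + + 1) * (k + + 1) + (k + + 1) * (k + + 1))) im≡)
      (trans (ᾱ-im k) (cong -_ (sym im≡)))))

odd-imaginary-representable : ∀ {α} k → im α ≡ + 1 + k * + 2 → Representable α
odd-imaginary-representable k im≡ =
  let d , d-odd , reps = odd-imaginary-representation k im≡
  in d , 1ᵍ , not-square-over-1 d d-odd , (λ ()) , reps

odd-real-representable : ∀ {α} k → re α ≡ + 1 + k * + 2 → Representable α
odd-real-representable {α} k re≡ =
  let d , d-odd , reps = odd-imaginary-representation {im α + (- re α) i} (- k - + 1) im-β
  in iᵍ *ᵍ d , iᵍ , not-square-over-i d d-odd , (λ ()) ,
     subst (RepresentsConjugates _ _) iβ≡α (conjugates-rotate reps)
  where
  odd-neg : ∀ k → - (+ 1 + k * + 2) ≡ + 1 + (- k - + 1) * + 2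
  odd-neg = solve-∀
  im-β : - re α ≡ + 1 + (- k - + 1) * + 2
  im-β = trans (cong -_ re≡) (odd-neg k)
  iβ-re : ∀ a b → + 0 * b - + 1 * (- a) ≡ a
  iβ-re = solve-∀
  iβ-im : ∀ a b → + 0 * (- a) + + 1 * b ≡ b
  iβ-im = solve-∀
  iβ≡α : iᵍ *ᵍ (im α + (- re α) i) ≡ α
  iβ≡α = cong₂ _+_i (iβ-re (re α) (im α)) (iβ-im (re α) (im α))

representable-scale : ∀ w {α} → Representable α → Representable (w *ᵍ w *ᵍ α)
representable-scale w (d₁ , d₂ , not-square , d₂≢0 , reps) =
  d₁ , d₂ , not-square , d₂≢0 , conjugates-scale w reps

size : ℤ[i] → ℕ
size z = ℤ.∣ re z ∣ ℕ.+ ℤ.∣ im z ∣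

size≡0⇒≡0ᵍ : ∀ z → size z ≡ 0 → z ≡ 0ᵍ
size≡0⇒≡0ᵍ z size≡0 =
  cong₂ _+_i (ℤP.∣i∣≡0⇒i≡0 (ℕP.m+n≡0⇒m≡0 _ size≡0)) (ℤP.∣i∣≡0⇒i≡0 (ℕP.m+n≡0⇒n≡0 _ size≡0))

1+i : ℤ[i]
1+i = (+ 1) + (+ 1) i

halve-by-1+i : ∀ a b → 1+i *ᵍ 1+i *ᵍ (b + (- a) i) ≡ (a * + 2) + (b * + 2) i
halve-by-1+i a b = cong₂ _+_i (halve-re a b) (halve-im a b)
  where
  halve-re : ∀ a b → + 0 * b - + 2 * (- a) ≡ a * + 2
  halve-re = solve-∀
  halve-im : ∀ a b → + 0 * (- a) + + 2 * b ≡ b * + 2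
  halve-im = solve-∀

size-halve-by-1+i : ∀ a b → size ((a * + 2) + (b * + 2) i) ≡ size (b + (- a) i) ℕ.+ size (b + (- a) i)
size-halve-by-1+i a b = begin
  ℤ.∣ a * + 2 ∣ ℕ.+ ℤ.∣ b * + 2 ∣                 ≡⟨ cong₂ ℕ._+_ (ℤP.abs-* a (+ 2)) (ℤP.abs-* b (+ 2)) ⟩
  ℤ.∣ a ∣ ℕ.* 2 ℕ.+ ℤ.∣ b ∣ ℕ.* 2                 ≡⟨ double ℤ.∣ a ∣ ℤ.∣ b ∣ ⟩
  (ℤ.∣ b ∣ ℕ.+ ℤ.∣ a ∣) ℕ.+ (ℤ.∣ b ∣ ℕ.+ ℤ.∣ a ∣) ≡⟨ cong (λ n → (ℤ.∣ b ∣ ℕ.+ n) ℕ.+ (ℤ.∣ b ∣ ℕ.+ n)) (ℤP.∣-i∣≡∣i∣ a) ⟨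
  size (b + (- a) i) ℕ.+ size (b + (- a) i)       ∎
  where
  open ≡-Reasoning
  double : ∀ x y → x ℕ.* 2 ℕ.+ y ℕ.* 2 ≡ (y ℕ.+ x) ℕ.+ (y ℕ.+ x)
  double = ℕ-Solver.solve-∀

representable : ∀ α → ¬ (α ≡ 0ᵍ) → Representable α
representable = All.wfRec (On.wellFounded size <-wellFounded) _ (λ α → ¬ (α ≡ 0ᵍ) → Representable α) step
  where
  step : ∀ α → (∀ {β} → size β ℕ.< size α → ¬ (β ≡ 0ᵍ) → Representable β) → ¬ (α ≡ 0ᵍ) → Representable α
  step α rec α≢0 with parity (im α) | parity (re α)
  ... | inj₂ (k , im≡)       | _                    = odd-imaginary-representable k im≡
  ... | inj₁ _               | inj₂ (k , re≡)       = odd-real-representable k re≡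
  ... | inj₁ (divides b im≡) | inj₁ (divides a re≡) =
    subst Representable α≡ (representable-scale 1+i (rec smaller β≢0))
    where
    β : ℤ[i]
    β = b + (- a) i
    α≡ : 1+i *ᵍ 1+i *ᵍ β ≡ α
    α≡ = trans (halve-by-1+i a b) (sym (cong₂ _+_i re≡ im≡))
    β≢0 : ¬ (β ≡ 0ᵍ)
    β≢0 β≡0 = α≢0 (trans (sym α≡) (cong (1+i *ᵍ 1+i *ᵍ_) β≡0))
    size≡ : size α ≡ size β ℕ.+ size β
    size≡ = trans (cong₂ (λ x y → ℤ.∣ x ∣ ℕ.+ ℤ.∣ y ∣) re≡ im≡) (size-halve-by-1+i a b)
    smaller : size β ℕ.< size α
    smaller = subst (size β ℕ.<_) (sym size≡) (ℕP.m<m+n (size β) (ℕP.n≢0⇒n>0 (β≢0 ∘ size≡0⇒≡0ᵍ β)))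

lemma8p3 : (α : ℤ[i]) → ¬ (α ≡ 0ᵍ) →
    ∃[ d₁ ] ∃[ d₂ ] ∃[ r ] ∃[ s ] ∃[ u ] ∃[ v ]
      (¬ (d₁ ≡ 0ᵍ) × ¬ (d₂ ≡ 0ᵍ) × ¬ IsSquareQuot d₁ d₂ ×
       (d₁ *ᵍ r *ᵍ r -ᵍ d₂ *ᵍ s *ᵍ s ≡ α) ×
       (d₁ *ᵍ u *ᵍ u -ᵍ d₂ *ᵍ v *ᵍ v ≡ conj α))
lemma8p3 α α≢0 =
  let d₁ , d₂ , not-square , d₂≢0 , represents r s α≡ , represents u v ᾱ≡ = representable α α≢0
  in d₁ , d₂ , r , s , u , v , not-square⇒≢0 d₂ not-square , d₂≢0 , not-square , α≡ , ᾱ≡
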